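{- Let $\mathcal{M}=(X,\vec{\mathcal{C}},\mathcal{V})$ be a quasi-discrete closure model and $\Phi$ any formula (of the language combining the IMLC and ISLCS operators). Then for every $x\in X$: $x\models\vec{\mathcal{N}}\Phi$ iff $x\models\overleftarrow{\rho}\,\Phi[\mathtt{false}]$, and $x\models\overleftarrow{\mathcal{N}}\Phi$ iff $x\models\vec{\rho}\,\Phi[\mathtt{false}]$.
   Context: For $R\subseteq X\times X$ on a non-empty set $X$, let $\mathcal{C}_R(A)=A\cup\{x:\exists a\in A,(a,x)\in R\}$. A QdCM is $(X,\vec{\mathcal{C}},\mathcal{V})$ with $\vec{\mathcal{C}}=\mathcal{C}_R$ for some $R$, $\mathcal{V}:AP\to\mathcal{P}(X)$ for a fixed set $AP$; $\overleftarrow{\mathcal{C}}=\mathcal{C}_{R^{ -1}}$. Paths: with $\mathcal{C}_{succ}(N')=N'\cup\{n+1:n\in N'\}$, a path is $\pi:\mathbb{N}\to X$ with $\pi(\mathcal{C}_{succ}(N'))\subseteq\vec{\mathcal{C}}(\pi(N'))$ for all $N'\subseteq\mathbb{N}$. Formulas: $\Phi::=p\mid\neg\Phi\mid\bigwedge_{i\in I}\Phi_i\mid\vec{\mathcal{N}}\Phi\mid\overleftarrow{\mathcal{N}}\Phi\mid\vec{\rho}\,\Phi_1[\Phi_2]\mid\overleftarrow{\rho}\,\Phi_1[\Phi_2]$; $\mathtt{false}$ abbreviates the empty disjunction (e.g. $\neg\bigwedge_{i\in\emptyset}$). Semantics: $x\models p$ iff $x\in\mathcal{V}(p)$; Boolean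 operators as usual; $x\models\vec{\mathcal{N}}\Phi$ iff $x\in\vec{\mathcal{C}}([\![\Phi]\!])$; $x\models\overleftarrow{\mathcal{N}}\Phi$ iff $x\in\overleftarrow{\mathcal{C}}([\![\Phi]\!])$, with $[\![\Phi]\!]=\{y:y\models\Phi\}$; $x\models\vec{\rho}\,\Phi_1[\Phi_2]$ iff there are a path $\pi$ and $\ell\in\mathbb{N}$ with $\pi(0)=x$, $\pi(\ell)\models\Phi_1$ and $\pi(j)\models\Phi_2$ for all $0<j<\ell$; $x\models\overleftarrow{\rho}\,\Phi_1[\Phi_2]$ iff there are a path $\pi$ and $\ell$ with $\pi(\ell)=x$, $\pi(0)\models\Phi_1$ and $\pi(j)\models\Phi_2$ for all $0<j<\ell$. -}

module Defs where

open import Level using (Level; Lift; _⊔_) renaming (suc to lsuc; zero to lzero)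
open import Data.Nat using (ℕ; zero; suc; _<_)
open import Data.Product using (Σ; _×_; ∃)
open import Data.Sum using (_⊎_)
open import Data.Empty using (⊥)
open import Relation.Nullary using (¬_)
open import Relation.Binary.PropositionalEquality using (_≡_)

Subset : ∀ {ℓ} → Set → Set (lsuc ℓ)
Subset {ℓ} A = A → Set ℓ

𝒞 : ∀ {ℓ} {X : Set} → (X → X → Set) → Subset {ℓ} X → Subset {ℓ} X
𝒞 {X = X} R A x = A x ⊎ Σ X (λ a → A a × R a x)

_⁻¹ : ∀ {X : Set} → (X → X → Set) → (X → X → Set)
(R ⁻¹) x y = R y x

image : ∀ {ℓ} {A B : Set} → (A → B) → Subset {ℓ} A → Subset {ℓ} B
image {A = A} f S b = Σ A (λ a → S a × f a ≡ b)

𝒞succ : Subset {lzero} ℕ → Subset {lzero} ℕ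
𝒞succ N' m = N' m ⊎ Σ ℕ (λ n → N' n × suc n ≡ m)

record QdCM (AP : Set) : Set₁ where
  field
    X        : Set
    R        : X → X → Set
    V        : AP → Subset {lzero} X
    nonEmpty : X

  C⃗ : ∀ {ℓ} → Subset {ℓ} X → Subset {ℓ} X
  C⃗ = 𝒞 R

  C⃖ : ∀ {ℓ} → Subset {ℓ} X → Subset {ℓ} X
  C⃖ = 𝒞 (R ⁻¹)

  IsPath : (ℕ → X) → Set₁
  IsPath π = (N' : Subset {lzero} ℕ) → (y : X) →
             image π (𝒞succ N') y → C⃗ (image π N') y

  Path : Set₁
  Path = Σ (ℕ → X) IsPath

data Form (AP : Set) : Set₁ where
  atom : AP → Form AP
  ¬ᶠ_  : Form AP → Form AP
  ⋀    : (I : Set) → (I → Form AP) → Form AP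
  N⃗    : Form AP → Form AP
  N⃖    : Form AP → Form AP
  ρ⃗    : Form AP → Form AP → Form AP
  ρ⃖    : Form AP → Form AP → Form AP

falseᶠ : ∀ {AP} → Form AP
falseᶠ = ¬ᶠ (⋀ ⊥ (λ ()))

module Semantics {AP : Set} (M : QdCM AP) where
  open QdCM M

  _⊨_ : X → Form AP → Set₁
  ⟦_⟧ : Form AP → Subset {lsuc lzero} X

  x ⊨ atom p    = Lift (lsuc lzero) (V p x)
  x ⊨ (¬ᶠ Φ)    = ¬ (x ⊨ Φ)
  x ⊨ ⋀ I Φs    = (i : I) → x ⊨ Φs i
  x ⊨ N⃗ Φ       = C⃗ ⟦ Φ ⟧ x
  x ⊨ N⃖ Φ       = C⃖ ⟦ Φ ⟧ x
  x ⊨ ρ⃗ Φ₁ Φ₂   = Σ Path λ π → Σ ℕ λ ℓ →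
      (Σ.proj₁ π 0 ≡ x) × (Σ.proj₁ π ℓ ⊨ Φ₁) ×
      ((j : ℕ) → 0 < j → j < ℓ → Σ.proj₁ π j ⊨ Φ₂)
  x ⊨ ρ⃖ Φ₁ Φ₂   = Σ Path λ π → Σ ℕ λ ℓ →
      (Σ.proj₁ π ℓ ≡ x) × (Σ.proj₁ π 0 ⊨ Φ₁) ×
      ((j : ℕ) → 0 < j → j < ℓ → Σ.proj₁ π j ⊨ Φ₂)

  ⟦ Φ ⟧ x = x ⊨ Φ

{-# OPTIONS --safe #-}
-- With guard false, a path witnessing ρ can have no interior points, so it
-- has length at most one; hence ρ⃖ Φ[false] and ρ⃗ Φ[false] say that x is
-- reached from, resp. reaches, a Φ-point in at most one R-step, which is
-- exactly membership in C⃗ ⟦Φ⟧, resp. C⃖ ⟦Φ⟧. Paths are precisely the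
-- sequences whose consecutive points are related by the reflexive closure
-- of R, so every such one-step witness is realised by a path.
module Submission where

open import Defs
open import Level using (Level)
open import Function.Bundles using (_⇔_; mk⇔; Equivalence)
open import Function.Construct.Composition using (_⇔-∘_)
open import Function.Construct.Symmetry using (⇔-sym)
open import Data.Product using (_×_; _,_; Σ; proj₁; proj₂)
open import Data.Sum using (inj₁; inj₂)
open import Data.Nat using (ℕ; zero; suc; _<_; s≤s; z≤n)
open import Data.Empty using (⊥-elim)
open import Relation.Nullary using (¬_)
open import Relation.Binary.Construct.Closure.Reflexive as Refl using (ReflClosure; [_])
open import Relation.Binary.PropositionalEquality using (_≡_; refl; subst)

ReflClosure-reverse : {X : Set} {R : X → X → Set} {a b : X} →
                      ReflClosure R a b → ReflClosure (R ⁻¹) b a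
ReflClosure-reverse Refl.refl = Refl.refl
ReflClosure-reverse [ r ]     = [ r ]

𝒞⇔Σ-ReflClosure : {ℓ : Level} {X : Set} (R : X → X → Set) (A : Subset {ℓ} X) (x : X) →
                  𝒞 R A x ⇔ Σ X (λ a → A a × ReflClosure R a x)
𝒞⇔Σ-ReflClosure R A x = mk⇔ to from
  where
  to : 𝒞 R A x → Σ _ (λ a → A a × ReflClosure R a x)
  to (inj₁ Ax)           = x , Ax , Refl.refl
  to (inj₂ (a , Aa , r)) = a , Aa , [ r ]

  from : Σ _ (λ a → A a × ReflClosure R a x) → 𝒞 R A x
  from (a , Aa , Refl.refl) = inj₁ Aa
  from (a , Aa , [ r ])     = inj₂ (a , Aa , r)

no-point-strictly-between-0-1 : {P : ℕ → Set₁} (j : ℕ) → 0 < j → j < 1 → P j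
no-point-strictly-between-0-1 (suc _) (s≤s _) (s≤s ())

module _ {AP : Set} (M : QdCM AP) where
  open QdCM M
  open Semantics M

  IsPath⇒step : {π : ℕ → X} → IsPath π → (n : ℕ) → ReflClosure R (π n) (π (suc n))
  IsPath⇒step {π} isPath n
    with Equivalence.to (𝒞⇔Σ-ReflClosure R (image π (_≡ n)) (π (suc n)))
           (isPath (_≡ n) (π (suc n)) (suc n , inj₂ (n , refl , refl) , refl))
  ... | _ , (_ , refl , refl) , s = s

  step⇒IsPath : {π : ℕ → X} → ((n : ℕ) → ReflClosure R (π n) (π (suc n))) → IsPath π
  step⇒IsPath     step N' y (m , inj₁ N'm , πm≡y) = inj₁ (m , N'm , πm≡y)
  step⇒IsPath {π} step N' _ (_ , inj₂ (n , N'n , refl) , refl) =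
    Equivalence.from (𝒞⇔Σ-ReflClosure R (image π N') (π (suc n)))
      (π n , (n , N'n , refl) , step n)

  segment : X → X → ℕ → X
  segment a b zero    = a
  segment a b (suc _) = b

  segment-path : {a b : X} → ReflClosure R a b → Path
  segment-path {a} {b} s = segment a b , step⇒IsPath segment-step
    where
    segment-step : (n : ℕ) → ReflClosure R (segment a b n) (segment a b (suc n))
    segment-step zero    = s
    segment-step (suc _) = Refl.refl

  ⊭falseᶠ : {y : X} → ¬ (y ⊨ falseᶠ)
  ⊭falseᶠ y⊨false = y⊨false (λ ())

  false-guarded⇒ReflClosure : (π : Path) (ℓ : ℕ) →
    ((j : ℕ) → 0 < j → j < ℓ → proj₁ π j ⊨ falseᶠ) →
    ReflClosure R (proj₁ π 0) (proj₁ π ℓ)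
  false-guarded⇒ReflClosure π zero          _     = Refl.refl
  false-guarded⇒ReflClosure π (suc zero)    _     = IsPath⇒step (proj₂ π) 0
  false-guarded⇒ReflClosure π (suc (suc ℓ)) guard =
    ⊥-elim (⊭falseᶠ (guard 1 (s≤s z≤n) (s≤s (s≤s z≤n))))

  ρ⃖-false⇔Σ-ReflClosure : (Φ : Form AP) (x : X) →
    x ⊨ ρ⃖ Φ falseᶠ ⇔ Σ X (λ a → a ⊨ Φ × ReflClosure R a x)
  ρ⃖-false⇔Σ-ReflClosure Φ x = mk⇔ to from
    where
    to : x ⊨ ρ⃖ Φ falseᶠ → Σ X (λ a → a ⊨ Φ × ReflClosure R a x)
    to (π , ℓ , πℓ≡x , π0⊨Φ , guard) =
      proj₁ π 0 , π0⊨Φ , subst (ReflClosure R _) πℓ≡x (false-guarded⇒ReflClosure π ℓ guard)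

    from : Σ X (λ a → a ⊨ Φ × ReflClosure R a x) → x ⊨ ρ⃖ Φ falseᶠ
    from (a , a⊨Φ , s) = segment-path s , 1 , refl , a⊨Φ , no-point-strictly-between-0-1

  ρ⃗-false⇔Σ-ReflClosure : (Φ : Form AP) (x : X) →
    x ⊨ ρ⃗ Φ falseᶠ ⇔ Σ X (λ a → a ⊨ Φ × ReflClosure (R ⁻¹) a x)
  ρ⃗-false⇔Σ-ReflClosure Φ x = mk⇔ to from
    where
    to : x ⊨ ρ⃗ Φ falseᶠ → Σ X (λ a → a ⊨ Φ × ReflClosure (R ⁻¹) a x)
    to (π , ℓ , π0≡x , πℓ⊨Φ , guard) =
      proj₁ π ℓ , πℓ⊨Φ , ReflClosure-reverse
        (subst (λ z → ReflClosure R z (proj₁ π ℓ)) π0≡x (false-guarded⇒ReflClosure π ℓ guard))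

    from : Σ X (λ a → a ⊨ Φ × ReflClosure (R ⁻¹) a x) → x ⊨ ρ⃗ Φ falseᶠ
    from (a , a⊨Φ , s) =
      segment-path (ReflClosure-reverse s) , 1 , refl , a⊨Φ , no-point-strictly-between-0-1

lemma1 : {AP : Set} (M : QdCM AP) (Φ : Form AP) (x : QdCM.X M) →
    let open Semantics M in
    (x ⊨ N⃗ Φ ⇔ x ⊨ ρ⃖ Φ falseᶠ) × (x ⊨ N⃖ Φ ⇔ x ⊨ ρ⃗ Φ falseᶠ)
lemma1 M Φ x =
    ⇔-sym (ρ⃖-false⇔Σ-ReflClosure M Φ x) ⇔-∘ 𝒞⇔Σ-ReflClosure R ⟦ Φ ⟧ x
  , ⇔-sym (ρ⃗-false⇔Σ-ReflClosure M Φ x) ⇔-∘ 𝒞⇔Σ-ReflClosure (R ⁻¹) ⟦ Φ ⟧ x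
  where
  open QdCM M using (R)
  open Semantics M using (⟦_⟧)
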